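{- Let $T$ be an eligible tenacity and assume $B(w)$ is a singleton for every vertex $w$ with $t_m\le\mathrm{t}(w)\le T$. Let $\mathcal{B}_{b,t}$ be a blossom with $t\le T$ and let $v\in\mathcal{B}_{b,t}$. Then there exists $k$ with $1\le k\le N(\mathcal{B}_{b,t})$ such that $b=\mathrm{base}^k(v)$. Furthermore, the vertices $\mathrm{base}(v),\dots,\mathrm{base}^{k-1}(v)$ all belong to $\mathcal{B}_{b,t}$.
   Context: $G=(V,E)$ is a finite undirected graph with matching $M$; alternating paths alternate matched/unmatched edges; $l_m$ is the minimum length of an alternating path between two distinct unmatched vertices ($\infty$ if none). $\mathrm{evenlevel}(v)$ ($\mathrm{oddlevel}(v)$) is the length of a minimum even (odd) length alternating path from some unmatched vertex to $v$ ($\infty$ if none). $v$ is outer if $\mathrm{evenlevel}(v)<\mathrm{oddlevel}(v)$. Tenacity $\mathrm{t}(v)=\mathrm{evenlevel}(v)+\mathrm{oddlevel}(v)$; $t_m$ is the minimum tenacity; odd $t$ with $t_m\le t<l_m$ is eligible. For $v$ of eligible tenacity $t$ and $p$ an evenlevel$(v)$ or oddlevel$(v)$ path (minimum such path) starting at unmatched $f$, $F(p,v)$ is the vertex of tenacity $>t$ on $p$ farthest from $f$; $B(v)$ is the set of all $F(p,v)$; if singleton, its element is $\mathrm{base}(v)$. Iterated bases: $\mathrm{base}^1(v)=\mathrm{base}(v)$, and $\mathrm{base}^{k+1}(v)=\mathrm{base}(\mathrm{base}^k(v))$ whenever $\mathrm{t}(\mathrm{base}^k(v))\le T$. Blossoms: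 for outer $b$ and odd $t\le T$ with $\mathrm{t}(b)>t$: $\mathcal{B}_{b,1}=\emptyset$, $S_{b,t}=\{v:\mathrm{t}(v)=t,\mathrm{base}(v)=b\}$, $\mathcal{B}_{b,t}=S_{b,t}\cup\bigcup_{w\in S_{b,t}\cup\{b\},\,w\text{ outer}}\mathcal{B}_{w,t-2}$. Nesting depth: $N(\mathcal{B}_{b,1})=0$, and $N(\mathcal{B}_{b,t})=1+\max_{w\in S_{b,t}\cup\{b\},\,w\text{ outer}}N(\mathcal{B}_{w,t-2})$ if $S_{b,t}\ne\emptyset$, and $N(\mathcal{B}_{b,t})=N(\mathcal{B}_{b,t-2})$ otherwise. -}

module Defs where

open import Data.Nat using (ℕ; zero; suc; _+_; _*_; _≤_; _<_; _⊔_; _≟_)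
open import Data.Nat.Properties using (_≤?_; _<?_)
open import Data.Fin using (Fin) renaming (_≟_ to _≟F_)
open import Data.Bool using (Bool; true; false; if_then_else_; _∧_; _∨_)
open import Data.List using (List; []; _∷_; _++_; length; foldr; map; allFin)
open import Data.Bool.ListAction using (any)
open import Data.List.Relation.Unary.All using (All)
open import Data.List.Relation.Unary.Linked using (Linked)
open import Data.List.Relation.Unary.Unique.Propositional using (Unique)
open import Data.List.Membership.Propositional using (_∈_)
open import Data.Product using (Σ; ∃; _×_; _,_)
open import Data.Sum using (_⊎_)
open import Data.Empty using (⊥)
open import Data.Unit using (⊤)
open import Relation.Nullary using (¬_; does)
open import Relation.Binary.PropositionalEquality using (_≡_; _≢_)

Even : ℕ → Set
Even d = ∃ λ k → d ≡ 2 * k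

Odd : ℕ → Set
Odd d = ∃ λ k → d ≡ 1 + 2 * k

data ℕ∞ : Set where
  fin : ℕ → ℕ∞
  ∞   : ℕ∞

_+∞_ : ℕ∞ → ℕ∞ → ℕ∞
fin a +∞ fin b = fin (a + b)
fin _ +∞ ∞     = ∞
∞     +∞ _     = ∞

data _≤∞_ : ℕ∞ → ℕ∞ → Set where
  fin≤fin : ∀ {a b} → a ≤ b → fin a ≤∞ fin b
  x≤∞     : ∀ {x} → x ≤∞ ∞

data _<∞_ : ℕ∞ → ℕ∞ → Set where
  fin<fin : ∀ {a b} → a < b → fin a <∞ fin b
  fin<∞   : ∀ {a} → fin a <∞ ∞

_==∞_ : ℕ∞ → ℕ∞ → Bool
fin a ==∞ fin b = does (a ≟ b)
∞     ==∞ ∞     = true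
_     ==∞ _     = false

_<∞ᵇ_ : ℕ∞ → ℕ∞ → Bool
fin a <∞ᵇ fin b = does (a <? b)
fin _ <∞ᵇ ∞     = true
∞     <∞ᵇ _     = false

MinOf : (ℕ → Set) → ℕ∞ → Set
MinOf P (fin d) = P d × (∀ d' → P d' → d ≤ d')
MinOf P ∞       = ∀ d → ¬ P d

record Graph (n : ℕ) : Set₁ where
  field
    Adj     : Fin n → Fin n → Set
    sym     : ∀ {u v} → Adj u v → Adj v u
    irrefl  : ∀ {u} → ¬ Adj u u

record Matching {n : ℕ} (G : Graph n) : Set₁ where
  open Graph G
  field
    M       : Fin n → Fin n → Set
    M⊆E     : ∀ {u v} → M u v → Adj u v
    M-sym   : ∀ {u v} → M u v → M v u
    M-func  : ∀ {u v w} → M u v → M u w → v ≡ w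

module Theory {n : ℕ} (G : Graph n) (Mat : Matching G) where
  open Graph G
  open Matching Mat

  Unmatched : Fin n → Set
  Unmatched v = ∀ w → ¬ M v w

  Alternates : List (Fin n) → Set
  Alternates (a ∷ b ∷ c ∷ rest) =
    ((M a b → ¬ M b c) × (¬ M a b → M b c)) × Alternates (b ∷ c ∷ rest)
  Alternates _ = ⊤

  record AltPath (p : List (Fin n)) : Set where
    field
      distinct : Unique p
      edges    : Linked Adj p
      alt      : Alternates p

  AltPathFromTo : Fin n → Fin n → ℕ → List (Fin n) → Set
  AltPathFromTo x y len p =
    AltPath p × (Σ (List (Fin n)) λ q → p ≡ x ∷ q × (Σ (List (Fin n)) λ r → p ≡ r ++ (y ∷ [])))
      × length p ≡ suc len

  FreePath : Fin n → ℕ → List (Fin n) → Set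
  FreePath v d p = Σ (Fin n) λ f → Unmatched f × AltPathFromTo f v d p

  IsEvenlevel : (Fin n → ℕ∞) → Set
  IsEvenlevel el = ∀ v → MinOf (λ d → Even d × ∃ λ p → FreePath v d p) (el v)

  IsOddlevel : (Fin n → ℕ∞) → Set
  IsOddlevel ol = ∀ v → MinOf (λ d → Odd d × ∃ λ p → FreePath v d p) (ol v)

  IsLm : ℕ∞ → Set
  IsLm lm = MinOf (λ d → Σ (Fin n) λ f → Σ (Fin n) λ g → f ≢ g × Unmatched f × Unmatched g
                         × ∃ λ p → AltPathFromTo f g d p) lm

  module Levels (el ol : Fin n → ℕ∞) where

    tenacity : Fin n → ℕ∞
    tenacity v = el v +∞ ol v

    Outer : Fin n → Set
    Outer v = el v <∞ ol v

    IsTm : ℕ∞ → Set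
    IsTm tm = MinOf (λ d → Σ (Fin n) λ w → tenacity w ≡ fin d) tm

    Eligible : ℕ∞ → ℕ∞ → ℕ → Set
    Eligible tm lm t = Odd t × tm ≤∞ fin t × fin t <∞ lm

    IsF : List (Fin n) → Fin n → Fin n → Set
    IsF p v x = tenacity v <∞ tenacity x ×
      Σ (List (Fin n)) λ pre → Σ (List (Fin n)) λ suf →
        p ≡ pre ++ (x ∷ suf) × All (λ y → tenacity y ≤∞ tenacity v) suf

    LevelPath : Fin n → List (Fin n) → Set
    LevelPath v p = Σ ℕ λ d → FreePath v d p × ((Even d × el v ≡ fin d) ⊎ (Odd d × ol v ≡ fin d))

    InB : Fin n → Fin n → Set
    InB v x = ∃ λ p → LevelPath v p × IsF p v x

    BIsSingleton : Fin n → Fin n → Set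
    BIsSingleton v x = ∀ y → (InB v y → y ≡ x) × (y ≡ x → InB v y)

    module Blossoms (base : Fin n → Fin n) where

      base^ : ℕ → Fin n → Fin n
      base^ zero    v = v
      base^ (suc k) v = base (base^ k v)

      S : Fin n → ℕ → Fin n → Set
      S b j v = tenacity v ≡ fin (1 + 2 * j) × base v ≡ b

      -- v ∈ 𝓑_{b,2j+1}
      InBlossom : Fin n → ℕ → Fin n → Set
      InBlossom b zero    v = ⊥
      InBlossom b (suc j) v =
        S b (suc j) v ⊎
        (Σ (Fin n) λ w → (S b (suc j) w ⊎ w ≡ b) × Outer w × InBlossom w j v)

      Sᵇ : Fin n → ℕ → Fin n → Bool
      Sᵇ b j v = (tenacity v ==∞ fin (1 + 2 * j)) ∧ does (base v ≟F b)

      maxOver : (Fin n → ℕ) → ℕ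
      maxOver f = foldr _⊔_ 0 (map f (allFin n))

      -- N(𝓑_{b,2j+1})
      depth : Fin n → ℕ → ℕ
      depth b zero    = 0
      depth b (suc j) =
        if any (Sᵇ b (suc j)) (allFin n)
        then suc (maxOver (λ w → if (Sᵇ b (suc j) w ∨ does (w ≟F b)) ∧ (el w <∞ᵇ ol w)
                                 then depth w j else 0))
        else depth b j

-- A vertex of S_{b,t} reaches b in one base step; any other vertex
-- of 𝓑_{b,t} lies in a child blossom 𝓑_{w,t-2} with w = b or w an outer vertex of
-- S_{b,t}, reaches w within N(𝓑_{w,t-2}) steps, and then b in one more step when
-- w ≠ b.  N(𝓑_{b,t}) exceeds the depth of each such child with w ∈ S_{b,t} and is at
-- least N(𝓑_{b,t-2}), so the count stays within N(𝓑_{b,t}).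
module Submission where

open import Defs
open import Data.Nat using (ℕ; suc; _+_; _*_; _≤_; _<_; _⊔_; _≟_; z≤n; s≤s)
open import Data.Nat.Properties
  using (≤-refl; ≤-trans; n≤1+n; m≤m⊔n; m≤n⊔m; *-monoʳ-≤; <-irrefl; m<1+n⇒m<n∨m≡n)
  renaming (_<?_ to _<ℕ?_)
open import Data.Fin using (Fin) renaming (_≟_ to _≟F_)
open import Data.Bool using (Bool; true; false; if_then_else_; _∧_; _∨_)
open import Data.Bool.Properties using (T-≡; ∨-zeroʳ)
open import Data.Bool.ListAction using (any)
open import Data.List using (List; _∷_; map; foldr; allFin)
open import Data.List.Relation.Unary.Any using (here; there)
open import Data.List.Relation.Unary.Any.Properties using (any⁺)
open import Data.List.Membership.Propositional using (_∈_; lose)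
open import Data.List.Membership.Propositional.Properties using (∈-allFin)
open import Data.Product using (Σ; _×_; _,_)
open import Data.Sum using (inj₁; inj₂)
open import Data.Empty using (⊥-elim)
open import Function.Bundles using (Equivalence)
open import Relation.Nullary using (does)
open import Relation.Nullary.Decidable using (dec-true)
open import Relation.Binary.PropositionalEquality using (_≡_; refl; sym; cong₂; subst)

any-∈ : {A : Set} (p : A → Bool) {x : A} {xs : List A} → x ∈ xs → p x ≡ true → any p xs ≡ true
any-∈ p x∈xs px = Equivalence.to T-≡ (any⁺ p (lose x∈xs (Equivalence.from T-≡ px)))

∈⇒≤-foldr-⊔ : {A : Set} (f : A → ℕ) {x : A} {xs : List A} → x ∈ xs → f x ≤ foldr _⊔_ 0 (map f xs)
∈⇒≤-foldr-⊔ f {xs = y ∷ _} (here refl) = m≤m⊔n (f y) _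
∈⇒≤-foldr-⊔ f {xs = y ∷ _} (there x∈xs) = ≤-trans (∈⇒≤-foldr-⊔ f x∈xs) (m≤n⊔m (f y) _)

<∞⇒<∞ᵇ : ∀ {x y} → x <∞ y → (x <∞ᵇ y) ≡ true
<∞⇒<∞ᵇ (fin<fin {a} {b} a<b) = dec-true (a <ℕ? b) a<b
<∞⇒<∞ᵇ fin<∞ = refl

≤∞-fin-weaken : ∀ {x a b} → x ≤∞ fin a → a ≤ b → x ≤∞ fin b
≤∞-fin-weaken (fin≤fin x≤a) a≤b = fin≤fin (≤-trans x≤a a≤b)

odd-mono : ∀ j → 1 + 2 * j ≤ 1 + 2 * suc j
odd-mono j = s≤s (*-monoʳ-≤ 2 (n≤1+n j))

module _ {n : ℕ} (G : Graph n) (Mat : Matching G) (el ol : Fin n → ℕ∞) (base : Fin n → Fin n) where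
  open Theory G Mat
  open Levels el ol
  open Blossoms base

  S⇒Sᵇ : ∀ {b j v} → S b j v → Sᵇ b j v ≡ true
  S⇒Sᵇ {b} {j} (t≡ , refl) rewrite t≡ | dec-true (1 + 2 * j ≟ 1 + 2 * j) refl = dec-true (b ≟F b) refl

  IsChild : Fin n → ℕ → Fin n → Bool
  IsChild b j w = (Sᵇ b (suc j) w ∨ does (w ≟F b)) ∧ (el w <∞ᵇ ol w)

  childDepth : Fin n → ℕ → Fin n → ℕ
  childDepth b j w = if IsChild b j w then depth w j else 0

  depth-child≤ : ∀ {b j w} → IsChild b j w ≡ true → depth w j ≤ maxOver (childDepth b j)
  depth-child≤ {b} {j} {w} child with ∈⇒≤-foldr-⊔ (childDepth b j) (∈-allFin w)
  ... | bound rewrite child = bound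

  S-child : ∀ {b j w} → S b (suc j) w → Outer w → IsChild b j w ≡ true
  S-child {b} {j} {w} w∈S outer =
    cong₂ (λ s o → (s ∨ does (w ≟F b)) ∧ o) (S⇒Sᵇ {j = suc j} w∈S) (<∞⇒<∞ᵇ outer)

  base-child : ∀ {b j} → Outer b → IsChild b j b ≡ true
  base-child {b} {j} outer
    rewrite dec-true (b ≟F b) refl | ∨-zeroʳ (Sᵇ b (suc j) b) | <∞⇒<∞ᵇ outer = refl

  depth-nonempty : ∀ {b j w} → S b (suc j) w → depth b (suc j) ≡ suc (maxOver (childDepth b j))
  depth-nonempty {b} {j} {w} w∈S rewrite any-∈ (Sᵇ b (suc j)) (∈-allFin w) (S⇒Sᵇ {j = suc j} w∈S) = refl

  depth-pos : ∀ {b j w} → S b (suc j) w → 1 ≤ depth b (suc j)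
  depth-pos w∈S rewrite depth-nonempty w∈S = s≤s z≤n

  depth-S< : ∀ {b j w} → S b (suc j) w → Outer w → depth w j < depth b (suc j)
  depth-S< w∈S outer rewrite depth-nonempty w∈S = s≤s (depth-child≤ (S-child w∈S outer))

  depth-base-mono : ∀ {b j} → Outer b → depth b j ≤ depth b (suc j)
  depth-base-mono {b} {j} outer with any (Sᵇ b (suc j)) (allFin n)
  ... | false = ≤-refl
  ... | true = ≤-trans (depth-child≤ (base-child outer)) (n≤1+n _)

  tenacity-InBlossom : ∀ {b j v} → InBlossom b j v → tenacity v ≤∞ fin (1 + 2 * j)
  tenacity-InBlossom {j = suc j} (inj₁ (t≡ , _)) rewrite t≡ = fin≤fin ≤-refl
  tenacity-InBlossom {j = suc j} (inj₂ (_ , _ , _ , v∈child)) =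
    ≤∞-fin-weaken (tenacity-InBlossom v∈child) (odd-mono j)

  base^-InBlossom : ∀ {b j v} → InBlossom b j v →
    Σ ℕ λ k → 1 ≤ k × k ≤ depth b j × b ≡ base^ k v
      × (∀ i → 1 ≤ i → i < k → InBlossom b j (base^ i v))
  base^-InBlossom {j = suc j} {v} (inj₁ v∈S@(_ , base≡b)) =
    1 , ≤-refl , depth-pos v∈S , sym base≡b , λ i 1≤i i<1 → ⊥-elim (<-irrefl refl (≤-trans i<1 1≤i))
  base^-InBlossom {b} {suc j} (inj₂ (b , inj₂ refl , outer , v∈child))
    with base^-InBlossom v∈child
  ... | k , 1≤k , k≤depth , b≡ , between =
    k , 1≤k , ≤-trans k≤depth (depth-base-mono outer) , b≡ ,
    λ i 1≤i i<k → inj₂ (b , inj₂ refl , outer , between i 1≤i i<k)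
  base^-InBlossom {b} {suc j} {v} (inj₂ (w , inj₁ w∈S@(_ , base≡b) , outer , v∈child))
    with base^-InBlossom v∈child
  ... | k , _ , k≤depth , w≡ , between =
    suc k , s≤s z≤n , ≤-trans (s≤s k≤depth) (depth-S< w∈S outer) ,
    subst (λ u → b ≡ base u) w≡ (sym base≡b) , between′
    where
    between′ : ∀ i → 1 ≤ i → i < suc k → InBlossom b (suc j) (base^ i v)
    between′ i 1≤i i<1+k with m<1+n⇒m<n∨m≡n i<1+k
    ... | inj₁ i<k = inj₂ (w , inj₁ w∈S , outer , between i 1≤i i<k)
    ... | inj₂ refl = inj₁ (subst (S b (suc j)) w≡ w∈S)

-- Since base is supplied as a function, the hypotheses that make base(w) well defined
-- (the levels, l_m, t_m, singleton B(w)) are unused, as are b outer and t(b) > t.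
lemma7p1 : {n : ℕ} (G : Graph n) (Mat : Matching G)
    (el ol : Fin n → ℕ∞) (tm lm : ℕ∞) (base : Fin n → Fin n) →
    Theory.IsEvenlevel G Mat el → Theory.IsOddlevel G Mat ol →
    Theory.IsLm G Mat lm → Theory.Levels.IsTm G Mat el ol tm →
    (T : ℕ) → Theory.Levels.Eligible G Mat el ol tm lm T →
    (∀ w → tm ≤∞ Theory.Levels.tenacity G Mat el ol w →
           Theory.Levels.tenacity G Mat el ol w ≤∞ fin T →
           Theory.Levels.BIsSingleton G Mat el ol w (base w)) →
    (b : Fin n) (j : ℕ) → Theory.Levels.Outer G Mat el ol b → 1 + 2 * j ≤ T →
    fin (1 + 2 * j) <∞ Theory.Levels.tenacity G Mat el ol b →
    (v : Fin n) → Theory.Levels.Blossoms.InBlossom G Mat el ol base b j v →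
    Σ ℕ λ k → 1 ≤ k × k ≤ Theory.Levels.Blossoms.depth G Mat el ol base b j
      × b ≡ Theory.Levels.Blossoms.base^ G Mat el ol base k v
      × (∀ i → 1 ≤ i → i < k →
           Theory.Levels.tenacity G Mat el ol (Theory.Levels.Blossoms.base^ G Mat el ol base i v) ≤∞ fin T
           × Theory.Levels.Blossoms.InBlossom G Mat el ol base b j (Theory.Levels.Blossoms.base^ G Mat el ol base i v))
lemma7p1 G Mat el ol _ _ base _ _ _ _ _ _ _ _ _ _ 1+2j≤T _ _ v∈𝓑
  with base^-InBlossom G Mat el ol base v∈𝓑
... | k , 1≤k , k≤depth , b≡ , between =
  k , 1≤k , k≤depth , b≡ ,
  λ i 1≤i i<k → ≤∞-fin-weaken (tenacity-InBlossom G Mat el ol base (between i 1≤i i<k)) 1+2j≤T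
              , between i 1≤i i<k
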